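{- The binary word $10$ does not have an internal zero at any $n \ge 0$.
   Context: A binary word is a finite sequence over $\{0,1\}$. An occurrence of $p = p_1\cdots p_l$ in $w = w_1\cdots w_n$ is a choice of indices $1 \le i_1 < \cdots < i_l \le n$ with $w_{i_1}\cdots w_{i_l} = p$; $c_p(w)$ is the number of occurrences, and $B_{n,p}(k)$ is the number of binary words $w$ of length $n$ with $c_p(w)=k$. The word $p$ has an internal zero at $n$ if there exist $0 \le k_1 < k_2 < k_3$ with $B_{n,p}(k_1) \ne 0$, $B_{n,p}(k_3) \ne 0$ and $B_{n,p}(k_2) = 0$. -}

module Defs where

open import Data.Bool using (Bool; true; false; if_then_else_)
open import Data.Bool.Properties using () renaming (_≟_ to _≟B_)
open import Data.Nat using (ℕ; zero; suc; _+_; _<_)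
open import Data.Nat.Properties using () renaming (_≟_ to _≟ℕ_)
open import Data.List using (List; []; _∷_; map; _++_; length; filter)
open import Data.Product using (∃-syntax; _×_)
open import Relation.Nullary using (¬_; does)
open import Relation.Binary.PropositionalEquality using (_≡_)

-- A binary word: a finite list over {0,1}, encoded as Bool (false = 0, true = 1).
Word : Set
Word = List Bool

-- c p w : number of occurrences of p in w as a (scattered) subsequence,
-- i.e. number of index choices i₁ < ⋯ < i_l with w_{i₁}⋯w_{i_l} = p.
-- Standard recursion: either the first letter of w is not used, or it is
-- used to match the first letter of p.
c : Word → Word → ℕ
c []      w       = 1
c (_ ∷ _) []      = 0
c (a ∷ p) (b ∷ w) = c (a ∷ p) w + (if does (a ≟B b) then c p w else 0)

words : ℕ → List Word
words zero    = [] ∷ []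
words (suc n) = map (false ∷_) (words n) ++ map (true ∷_) (words n)

B : ℕ → Word → ℕ → ℕ
B n p k = length (filter (λ w → c p w ≟ℕ k) (words n))

HasInternalZero : ℕ → Word → Set
HasInternalZero n p =
  ∃[ k₁ ] ∃[ k₂ ] ∃[ k₃ ]
    (k₁ < k₂) × (k₂ < k₃) × ¬ (B n p k₁ ≡ 0) × ¬ (B n p k₃ ≡ 0) × (B n p k₂ ≡ 0)

-- Turning an adjacent factor 10 of w into 01 keeps its length and destroys exactly
-- one occurrence of 10 (the pair itself; every other pair keeps its status). So if
-- some word of length n has k occurrences of 10, then words of length n realise every
-- value 0, 1, …, k, and the set of attained values has no gaps.
module Submission where

open import Defs
open import Data.Bool using (true; false)
open import Data.Nat using (ℕ; zero; suc; _+_; _≤′_; ≤′-refl; ≤′-step)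
open import Data.Nat.Properties using (+-identityʳ; +-comm; +-suc; m+n≡0⇒n≡0; suc-injective; ≤⇒≤′; <⇒≤; _≟_)
open import Data.List using (List; []; _∷_; map; length; filter)
open import Data.List.Membership.Propositional using (_∈_)
open import Data.List.Membership.Propositional.Properties
  using (∈-map⁺; ∈-map⁻; ∈-++⁺ˡ; ∈-++⁺ʳ; ∈-++⁻; ∈-filter⁺; ∈-filter⁻)
open import Data.List.Relation.Unary.Any using (here; there)
open import Data.Product using (∃-syntax; _×_; _,_)
open import Data.Sum using (inj₁; inj₂)
open import Relation.Nullary using (¬_; contradiction)
open import Relation.Binary.PropositionalEquality
  using (_≡_; refl; sym; trans; cong; cong₂; subst; module ≡-Reasoning)

c₀ : Word → ℕ
c₀ = c (false ∷ [])

c₁₀ : Word → ℕ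
c₁₀ = c (true ∷ false ∷ [])

c₀-true : ∀ w → c₀ (true ∷ w) ≡ c₀ w
c₀-true w = +-identityʳ (c₀ w)

c₀-false : ∀ w → c₀ (false ∷ w) ≡ suc (c₀ w)
c₀-false w = +-comm (c₀ w) 1

c₁₀-false : ∀ w → c₁₀ (false ∷ w) ≡ c₁₀ w
c₁₀-false w = +-identityʳ (c₁₀ w)

infix 4 _≈_

record _≈_ (v w : Word) : Set where
  constructor mk≈
  field
    length-≡ : length v ≡ length w
    c₀-≡     : c₀ v ≡ c₀ w

≈-trans : ∀ {u v w} → u ≈ v → v ≈ w → u ≈ w
≈-trans (mk≈ ℓ₁ z₁) (mk≈ ℓ₂ z₂) = mk≈ (trans ℓ₁ ℓ₂) (trans z₁ z₂)

∷false-cong : ∀ {v w} → v ≈ w → false ∷ v ≈ false ∷ w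
∷false-cong {v} {w} (mk≈ ℓ z) = mk≈ (cong suc ℓ) (trans (c₀-false v) (trans (cong suc z) (sym (c₀-false w))))

∷true-cong : ∀ {v w} → v ≈ w → true ∷ v ≈ true ∷ w
∷true-cong {v} {w} (mk≈ ℓ z) = mk≈ (cong suc ℓ) (trans (c₀-true v) (trans z (sym (c₀-true w))))

Rearrangement : Word → ℕ → Set
Rearrangement w k = ∃[ v ] v ≈ w × c₁₀ v ≡ k

rearrangement-∷false : ∀ {w k} → Rearrangement w k → Rearrangement (false ∷ w) k
rearrangement-∷false (v , v≈w , v₁₀) = false ∷ v , ∷false-cong v≈w , trans (c₁₀-false v) v₁₀

rearrangement-∷true : ∀ {w k} → Rearrangement w k → Rearrangement (true ∷ w) (k + c₀ w)
rearrangement-∷true (v , v≈w@(mk≈ _ z) , v₁₀) = true ∷ v , ∷true-cong v≈w , cong₂ _+_ v₁₀ z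

-- c₁₀ (true ∷ w) ≥ c₀ w, so the summand c₁₀ (true ∷ w) of c₁₀ (true ∷ true ∷ w) cannot vanish alone.
c₁₀-∷true-positive : ∀ w {k} → c₁₀ (true ∷ true ∷ w) ≡ suc k →
                     ∃[ j ] c₁₀ (true ∷ w) ≡ suc j × k ≡ j + c₀ (true ∷ w)
c₁₀-∷true-positive w eq with c₁₀ (true ∷ w) in c₁₀w≡
... | zero with () ← trans (sym eq) (trans (c₀-true w) (m+n≡0⇒n≡0 (c₁₀ w) c₁₀w≡))
... | suc j = j , refl , suc-injective (sym eq)

c₁₀-suc⇒rearrangement : ∀ w {k} → c₁₀ w ≡ suc k → Rearrangement w k
c₁₀-suc⇒rearrangement [] ()
c₁₀-suc⇒rearrangement (true ∷ []) ()
c₁₀-suc⇒rearrangement (false ∷ w) eq =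
  rearrangement-∷false (c₁₀-suc⇒rearrangement w (trans (sym (c₁₀-false w)) eq))
c₁₀-suc⇒rearrangement (true ∷ false ∷ w) {k} eq =
  false ∷ true ∷ w , mk≈ refl zeros , swapped
  where
  open ≡-Reasoning
  zeros : c₀ (false ∷ true ∷ w) ≡ c₀ (true ∷ false ∷ w)
  zeros = begin
    c₀ (false ∷ true ∷ w) ≡⟨ c₀-false (true ∷ w) ⟩
    suc (c₀ (true ∷ w))   ≡⟨ cong suc (c₀-true w) ⟩
    suc (c₀ w)            ≡⟨ sym (c₀-false w) ⟩
    c₀ (false ∷ w)        ≡⟨ sym (c₀-true (false ∷ w)) ⟩
    c₀ (true ∷ false ∷ w) ∎
  swapped : c₁₀ (false ∷ true ∷ w) ≡ k
  swapped = suc-injective (begin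
    suc (c₁₀ (false ∷ true ∷ w)) ≡⟨ cong suc (c₁₀-false (true ∷ w)) ⟩
    suc (c₁₀ w + c₀ w)           ≡⟨ sym (+-suc (c₁₀ w) (c₀ w)) ⟩
    c₁₀ w + suc (c₀ w)           ≡⟨ cong₂ _+_ (sym (c₁₀-false w)) (sym (c₀-false w)) ⟩
    c₁₀ (true ∷ false ∷ w)       ≡⟨ eq ⟩
    suc k                        ∎)
c₁₀-suc⇒rearrangement (true ∷ w@(true ∷ w′)) eq =
  let _ , c₁₀w≡ , k≡ = c₁₀-∷true-positive w′ eq in
  subst (Rearrangement (true ∷ w)) (sym k≡) (rearrangement-∷true (c₁₀-suc⇒rearrangement w c₁₀w≡))

rearrangement-≤′ : ∀ w {j k} → j ≤′ k → c₁₀ w ≡ k → Rearrangement w j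
rearrangement-≤′ w ≤′-refl     eq = w , mk≈ refl refl , eq
rearrangement-≤′ w (≤′-step j≤k) eq =
  let v , v≈w , v₁₀ = c₁₀-suc⇒rearrangement w eq
      u , u≈v , u₁₀ = rearrangement-≤′ v j≤k v₁₀
  in  u , ≈-trans u≈v v≈w , u₁₀

∈-words : ∀ w → w ∈ words (length w)
∈-words []          = here refl
∈-words (false ∷ w) = ∈-++⁺ˡ (∈-map⁺ (false ∷_) (∈-words w))
∈-words (true ∷ w)  = ∈-++⁺ʳ (map (false ∷_) (words (length w))) (∈-map⁺ (true ∷_) (∈-words w))

words-length : ∀ n {w} → w ∈ words n → length w ≡ n
words-length zero    (here refl) = refl
words-length (suc n) w∈ with ∈-++⁻ (map (false ∷_) (words n)) w∈
... | inj₁ w∈₀ with ∈-map⁻ (false ∷_) w∈₀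
...   | _ , v∈ , refl = cong suc (words-length n v∈)
words-length (suc n) w∈ | inj₂ w∈₁ with ∈-map⁻ (true ∷_) w∈₁
...   | _ , v∈ , refl = cong suc (words-length n v∈)

B≢0⇒attained : ∀ n p k → ¬ B n p k ≡ 0 → ∃[ w ] length w ≡ n × c p w ≡ k
B≢0⇒attained n p k B≢0 with filter (λ w → c p w ≟ k) (words n) in filter≡
... | []    = contradiction refl B≢0
... | w ∷ _ =
  let w∈ , cpw≡k = ∈-filter⁻ (λ w → c p w ≟ k) (subst (w ∈_) (sym filter≡) (here refl))
  in  w , words-length n w∈ , cpw≡k

attained⇒B≢0 : ∀ n p k w → length w ≡ n → c p w ≡ k → ¬ B n p k ≡ 0
attained⇒B≢0 _ p k w refl cpw≡k = nonempty (∈-filter⁺ (λ w → c p w ≟ k) (∈-words w) cpw≡k)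
  where
  nonempty : ∀ {xs : List Word} {x} → x ∈ xs → ¬ length xs ≡ 0
  nonempty (here _)  ()
  nonempty (there _) ()

mainTheorem13 : (n : ℕ) → ¬ HasInternalZero n (true ∷ false ∷ [])
mainTheorem13 n (_ , k₂ , k₃ , _ , k₂<k₃ , _ , B₃≢0 , B₂≡0) =
  let w , ∣w∣≡n , w₁₀ = B≢0⇒attained n (true ∷ false ∷ []) k₃ B₃≢0
      v , mk≈ ∣v∣≡∣w∣ _ , v₁₀ = rearrangement-≤′ w (≤⇒≤′ (<⇒≤ k₂<k₃)) w₁₀
  in  attained⇒B≢0 n (true ∷ false ∷ []) k₂ v (trans ∣v∣≡∣w∣ ∣w∣≡n) v₁₀ B₂≡0
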